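{- Let $\psi$ be a diophantine formula (a diophantine semiformula without variables) which is associated with $\phi(\bar w)\in\mathcal A$, where $\bar w$ lists the (table) variables of $\phi$. Then $\mathcal N\models\psi$ iff $\phi(\bar\ast)$ is solvable, where $\bar\ast$ is a sequence of pairwise distinct unknowns.
   Context: First-order predicate calculus with identity $\doteq$, over a language with countably many variables and countably infinitely many function and predicate symbols of every arity; terms are variable-free; $\models\theta$ means $\theta$ is true in every structure. An infinite set of distinguished constants, called unknowns, is singled out. A quantifier-free formula $\phi(\bar\ast)$ (unknowns among $\bar\ast$) is solvable if there are terms $\bar a$ without unknowns with $\models\phi(\bar a)$. $S^0(t)=t$, $S^{m+1}(t)=S(S^m(t))$. The language $P$: distinct constants $0,\hat 0,\tilde 0,k,\tilde k$ (not unknowns), unary $S$, binary $\mathrm{pr}$. Define: $\mathit{Num}(x)$: $0\doteq S(0)\to 0\doteq x$; $\widetilde{\mathit{Num}}(x)$: $\tilde0\doteq S(\tilde0)\to\tilde0\doteq x$; $\mathit{Sim}(x,y)$: $0\doteq\tilde0\to x\doteq y$; $\mathit{Plus}(x,y,z)$: $\tilde0\doteq x\to z\doteq y$; $\mathit{Add}(x,y,z,w)$: $\widetilde{\mathit{Num}}(w)\wedge\mathit{Sim}(y,w)\wedge\mathit{Plus}(x,w,z)$; $\mathit{Tab}(x)$: $0\doteq S(0)\wedge k\doteq\mathrm{pr}(\mathrm{pr}(0,0),k)\to k\doteq x$; $\widetilde{\mathit{Tab}}(x)$: $\hat0\doteq S(\hat0)\wedge\tilde0\doteq S(\tilde0)\wedge\tilde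 k\doteq\mathrm{pr}(\mathrm{pr}(\hat0,\tilde0),\tilde k)\to\tilde k\doteq x$; $\widetilde{\mathit{Sim}}(x,y)$: $0\doteq\hat0\wedge0\doteq\tilde0\wedge k\doteq\tilde k\to x\doteq y$; $\mathit{Tim}(x,y,z,w,\tilde w)$: $\hat0\doteq S(0)\wedge\tilde0\doteq x\wedge\tilde k\doteq\mathrm{pr}(\mathrm{pr}(0,0),k)\to\tilde w\doteq\mathrm{pr}(\mathrm{pr}(y,z),w)$; $\mathit{Mul}(x,y,z,w,\tilde w)$: $\mathit{Tab}(w)\wedge\widetilde{\mathit{Tab}}(\tilde w)\wedge\widetilde{\mathit{Sim}}(w,\tilde w)\wedge\mathit{Tim}(x,y,z,w,\tilde w)$. A diophantine semiformula is a conjunction of atomic formulas $a+b\doteq c$ and $a\cdot b\doteq c$ of the language of arithmetic $\{0,S,+,\cdot\}$ where each of $a,b,c$ is a variable or a $0$-numeral $S^m(0)$; $\mathcal N$ is the standard model of natural numbers. Variables are split into two disjoint infinite sets: numeric variables (those used in diophantine semiformulas) and table variables. Association is defined inductively: $a+b\doteq c$ is associated with any $\mathit{Num}(a)\wedge\mathit{Num}(b)\wedge\mathit{Num}(c)\wedge\mathit{Add}(a,b,c,w)$ ($w$ a table variable); $a\cdot b\doteq c$ with any $\mathit{Num}(a)\wedge\mathit{Num}(b)\wedge\mathit{Num}(c)\wedge\mathit{Mul}(a,b,c,w_1,w_2)$ ($w_1,w_2$ distinct table variables); $\psi_1\wedge\psi_2$ with any $\phi_1\wedge\phi_2$ where $\psi_j$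 is associated with $\phi_j$ and $\phi_1,\phi_2$ have disjoint table variables. $\mathcal A$ is the class of all semiformulas of $P$ associated with some diophantine semiformula. -}

module Defs where

open import Data.Nat using (ℕ; zero; suc)
open import Data.Vec using (Vec; []; _∷_)
open import Data.Vec.Relation.Unary.All using (All)
open import Data.List using (List; []; _∷_; _++_)
open import Data.List.Relation.Binary.Disjoint.Propositional using (Disjoint)
open import Data.Product using (_×_; Σ; _,_)
open import Data.Sum using (_⊎_; inj₁; inj₂)
open import Data.Empty using (⊥)
open import Data.Unit using (⊤)
open import Relation.Binary.PropositionalEquality using (_≡_; _≢_)
open import Relation.Nullary using (¬_)
open import Data.Nat using () renaming (_+_ to _+ℕ_; _*_ to _*ℕ_)

-- The first-order language
-- Function symbols: the five distinguished constants of P, S, pr,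
-- the unknowns (countably many constants), and countably infinitely
-- many further function symbols of every arity.

data Sym : Set where
  s0 ŝ0 s̃0 sk s̃k : Sym
  sS spr : Sym
  unk : ℕ → Sym
  extra : (n i : ℕ) → Sym

arity : Sym → ℕ
arity sS = 1
arity spr = 2
arity (extra n i) = n
arity _ = 0

-- terms over a set X of variables (closed terms: X = ⊥)
data Term (X : Set) : Set where
  var : X → Term X
  app : (f : Sym) → Vec (Term X) (arity f) → Term X

infix 6 _≐_
infixr 5 _∧_
infixr 4 _⇒_
data Formula (X : Set) : Set where
  _≐_ : Term X → Term X → Formula X
  rel : (n i : ℕ) → Vec (Term X) n → Formula X
  ff : Formula X
  ¬' : Formula X → Formula X
  _∧_ _∨_ _⇒_ : Formula X → Formula X → Formula X

record Structure : Set₁ where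
  field
    Carrier : Set
    fun : (f : Sym) → Vec Carrier (arity f) → Carrier
    prd : (n i : ℕ) → Vec Carrier n → Set
open Structure

mutual
  eval : (M : Structure) → Term ⊥ → Carrier M
  eval M (var ())
  eval M (app f ts) = fun M f (evals M ts)

  evals : (M : Structure) → ∀ {n} → Vec (Term ⊥) n → Vec (Carrier M) n
  evals M [] = []
  evals M (t ∷ ts) = eval M t ∷ evals M ts

Sat : (M : Structure) → Formula ⊥ → Set
Sat M (s ≐ t) = eval M s ≡ eval M t
Sat M (rel n i ts) = prd M n i (evals M ts)
Sat M ff = ⊥
Sat M (¬' φ) = ¬ Sat M φ
Sat M (φ ∧ χ) = Sat M φ × Sat M χ
Sat M (φ ∨ χ) = Sat M φ ⊎ Sat M χ
Sat M (φ ⇒ χ) = Sat M φ → Sat M χ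

Valid : Formula ⊥ → Set₁
Valid θ = (M : Structure) → Sat M θ

mutual
  substT : {X Y : Set} → (X → Term Y) → Term X → Term Y
  substT σ (var x) = σ x
  substT σ (app f ts) = app f (substTs σ ts)

  substTs : {X Y : Set} → (X → Term Y) → ∀ {n} → Vec (Term X) n → Vec (Term Y) n
  substTs σ [] = []
  substTs σ (t ∷ ts) = substT σ t ∷ substTs σ ts

substF : {X Y : Set} → (X → Term Y) → Formula X → Formula Y
substF σ (s ≐ t) = substT σ s ≐ substT σ t
substF σ (rel n i ts) = rel n i (substTs σ ts)
substF σ ff = ff
substF σ (¬' φ) = ¬' (substF σ φ)
substF σ (φ ∧ χ) = substF σ φ ∧ substF σ χ
substF σ (φ ∨ χ) = substF σ φ ∨ substF σ χ
substF σ (φ ⇒ χ) = substF σ φ ⇒ substF σ χ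

mutual
  varsT : {X : Set} → Term X → List X
  varsT (var x) = x ∷ []
  varsT (app f ts) = varsTs ts

  varsTs : {X : Set} → ∀ {n} → Vec (Term X) n → List X
  varsTs [] = []
  varsTs (t ∷ ts) = varsT t ++ varsTs ts

varsF : {X : Set} → Formula X → List X
varsF (s ≐ t) = varsT s ++ varsT t
varsF (rel n i ts) = varsTs ts
varsF ff = []
varsF (¬' φ) = varsF φ
varsF (φ ∧ χ) = varsF φ ++ varsF χ
varsF (φ ∨ χ) = varsF φ ++ varsF χ
varsF (φ ⇒ χ) = varsF φ ++ varsF χ

mutual
  substUT : (ℕ → Term ⊥) → Term ⊥ → Term ⊥
  substUT σ (var ())
  substUT σ (app (unk i) _) = σ i
  substUT σ (app f ts) = app f (substUTs σ ts)

  substUTs : (ℕ → Term ⊥) → ∀ {n} → Vec (Term ⊥) n → Vec (Term ⊥) n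
  substUTs σ [] = []
  substUTs σ (t ∷ ts) = substUT σ t ∷ substUTs σ ts

substUF : (ℕ → Term ⊥) → Formula ⊥ → Formula ⊥
substUF σ (s ≐ t) = substUT σ s ≐ substUT σ t
substUF σ (rel n i ts) = rel n i (substUTs σ ts)
substUF σ ff = ff
substUF σ (¬' φ) = ¬' (substUF σ φ)
substUF σ (φ ∧ χ) = substUF σ φ ∧ substUF σ χ
substUF σ (φ ∨ χ) = substUF σ φ ∨ substUF σ χ
substUF σ (φ ⇒ χ) = substUF σ φ ⇒ substUF σ χ

mutual
  NoUnk : Term ⊥ → Set
  NoUnk (var ())
  NoUnk (app (unk i) _) = ⊥
  NoUnk (app f ts) = NoUnks ts

  NoUnks : ∀ {n} → Vec (Term ⊥) n → Set
  NoUnks [] = ⊤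
  NoUnks (t ∷ ts) = NoUnk t × NoUnks ts

Solvable : Formula ⊥ → Set₁
Solvable θ = Σ (ℕ → Term ⊥) λ a → ((i : ℕ) → NoUnk (a i)) × Valid (substUF a θ)

module P {X : Set} where
  𝟘 0̂ 0̃ 𝕜 𝕜̃ : Term X
  𝟘 = app s0 []
  0̂ = app ŝ0 []
  0̃ = app s̃0 []
  𝕜 = app sk []
  𝕜̃ = app s̃k []

  S : Term X → Term X
  S t = app sS (t ∷ [])

  pr : Term X → Term X → Term X
  pr a b = app spr (a ∷ b ∷ [])

  S^ : ℕ → Term X → Term X
  S^ zero t = t
  S^ (suc m) t = S (S^ m t)

  Num Num~ Tab Tab~ : Term X → Formula X
  Num x = 𝟘 ≐ S 𝟘 ⇒ 𝟘 ≐ x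
  Num~ x = 0̃ ≐ S 0̃ ⇒ 0̃ ≐ x
  Tab x = (𝟘 ≐ S 𝟘 ∧ 𝕜 ≐ pr (pr 𝟘 𝟘) 𝕜) ⇒ 𝕜 ≐ x
  Tab~ x = (0̂ ≐ S 0̂ ∧ 0̃ ≐ S 0̃ ∧ 𝕜̃ ≐ pr (pr 0̂ 0̃) 𝕜̃) ⇒ 𝕜̃ ≐ x

  Sim Sim~ : Term X → Term X → Formula X
  Sim x y = 𝟘 ≐ 0̃ ⇒ x ≐ y
  Sim~ x y = (𝟘 ≐ 0̂ ∧ 𝟘 ≐ 0̃ ∧ 𝕜 ≐ 𝕜̃) ⇒ x ≐ y

  Plus : Term X → Term X → Term X → Formula X
  Plus x y z = 0̃ ≐ x ⇒ z ≐ y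

  Add : Term X → Term X → Term X → Term X → Formula X
  Add x y z w = Num~ w ∧ Sim y w ∧ Plus x w z

  Tim Mul : Term X → Term X → Term X → Term X → Term X → Formula X
  Tim x y z w w~ = (0̂ ≐ S 𝟘 ∧ 0̃ ≐ x ∧ 𝕜̃ ≐ pr (pr 𝟘 𝟘) 𝕜) ⇒ w~ ≐ pr (pr y z) w
  Mul x y z w w~ = Tab w ∧ Tab~ w~ ∧ Sim~ w w~ ∧ Tim x y z w w~

-- Diophantine semiformulas over a set V of numeric variables
-- (diophantine formulas: V = ⊥)

data DTerm (V : Set) : Set where
  dvar : V → DTerm V
  dnum : ℕ → DTerm V       -- the 0-numeral S^m(0)

infixr 5 _d∧_
data DForm (V : Set) : Set where
  _⊕_≐_ : DTerm V → DTerm V → DTerm V → DForm V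
  _⊗_≐_ : DTerm V → DTerm V → DTerm V → DForm V
  _d∧_  : DForm V → DForm V → DForm V

evalN : DTerm ⊥ → ℕ
evalN (dvar ())
evalN (dnum m) = m

NSat : DForm ⊥ → Set
NSat (a ⊕ b ≐ c) = evalN a +ℕ evalN b ≡ evalN c
NSat (a ⊗ b ≐ c) = evalN a *ℕ evalN b ≡ evalN c
NSat (ψ d∧ χ) = NSat ψ × NSat χ

-- Association.  Semiformulas of P have variables V ⊎ ℕ:
-- inj₁ v are numeric variables, inj₂ w are table variables.

trD : {V : Set} → DTerm V → Term (V ⊎ ℕ)
trD (dvar v) = var (inj₁ v)
trD (dnum m) = P.S^ m P.𝟘

tabs : {V : Set} → List (V ⊎ ℕ) → List ℕ
tabs [] = []
tabs (inj₁ _ ∷ xs) = tabs xs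
tabs (inj₂ w ∷ xs) = w ∷ tabs xs

tvars : {V : Set} → Formula (V ⊎ ℕ) → List ℕ
tvars φ = tabs (varsF φ)

tv : {V : Set} → ℕ → Term (V ⊎ ℕ)
tv w = var (inj₂ w)

data Assoc {V : Set} : DForm V → Formula (V ⊎ ℕ) → Set where
  assoc+ : (a b c : DTerm V) (w : ℕ) →
    Assoc (a ⊕ b ≐ c)
      (P.Num (trD a) ∧ P.Num (trD b) ∧ P.Num (trD c) ∧ P.Add (trD a) (trD b) (trD c) (tv w))
  assoc· : (a b c : DTerm V) (w₁ w₂ : ℕ) → w₁ ≢ w₂ →
    Assoc (a ⊗ b ≐ c)
      (P.Num (trD a) ∧ P.Num (trD b) ∧ P.Num (trD c) ∧ P.Mul (trD a) (trD b) (trD c) (tv w₁) (tv w₂))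
  assoc∧ : {ψ₁ ψ₂ : DForm V} {φ₁ φ₂ : Formula (V ⊎ ℕ)} →
    Assoc ψ₁ φ₁ → Assoc ψ₂ φ₂ → Disjoint (tvars φ₁) (tvars φ₂) →
    Assoc (ψ₁ d∧ ψ₂) (φ₁ ∧ φ₂)

-- φ(*̄): replace each table variable w by the unknown number u w
unknownsFor : (ℕ → ℕ) → ⊥ ⊎ ℕ → Term ⊥
unknownsFor u (inj₁ ())
unknownsFor u (inj₂ w) = app (unk (u w)) []

module Submission where

open import Defs
open import Data.Nat using (ℕ)
open import Data.Sum using (_⊎_)
open import Data.Empty using (⊥)
open import Data.List.Membership.Propositional using (_∈_)
open import Relation.Binary.PropositionalEquality using (_≡_)
open import Function.Bundles using (_⇔_)

open import Data.Nat using (zero; suc; _+_; _*_)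
open import Data.Nat.Properties using (+-comm; *-comm; +-identityʳ; _≟_)
open import Data.Sum using (inj₁; inj₂)
open import Data.Unit using (⊤; tt)
open import Data.Product using (∃-syntax; _×_; _,_; proj₁; proj₂)
open import Data.Product.Properties using (,-injectiveˡ; ,-injectiveʳ)
open import Data.Vec using (Vec; []; _∷_)
open import Data.List using (List; []; _∷_; _++_)
open import Data.List.Properties using (∷-injective)
open import Data.List.Relation.Unary.Any as Any using (here; there; any?)
open import Data.List.Relation.Unary.Any.Properties using (lookup-result)
open import Data.List.Relation.Binary.Disjoint.Propositional using (Disjoint)
open import Data.List.Membership.Propositional.Properties using (∈-++⁺ˡ; ∈-++⁺ʳ; ∈-lookup)
open import Data.List.Membership.DecPropositional _≟_ using (_∈?_)
open import Relation.Binary.PropositionalEquality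
  using (_≢_; refl; sym; trans; cong; cong₂; subst; module ≡-Reasoning)
open import Relation.Nullary using (¬_; yes; no; contradiction)
open import Relation.Unary using (Decidable)
open import Function.Base using (id; _∘_)
open import Function.Bundles using (mk⇔)
open Structure
open ≡-Reasoning

-- Both directions are reduced to semantics of φ itself: replacing the table
-- variables by unknowns and the unknowns by terms ā amounts to evaluating φ in
-- the expansion M ⟨ ā ⟩ (M with the unknowns reinterpreted) under the
-- environment sending w to the value of ā(u w)  (sat-instance).
--
-- (⇒) Each true atom a+b≐c / a·b≐c is *realized*: there are fixed terms for its
-- table variables making it true in every structure, namely S^b(0̃) for Add and
-- the multiplication table ⟨(i, i·a) | i < b⟩ over the two sets of constants
-- for Mul.  Realizers of conjuncts combine because their table variables are
-- disjoint, and the injectivity of u lets the unknowns pick them up.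
--
-- (⇐) The valid instance is evaluated in small countermodels.  Two "recognizer"
-- structures, in which the antecedents of Num~, Tab and Tab~ hold, force the
-- solution terms to have the syntactic shape of a numeral S^j(0̃) or of a table;
-- the structures NT of numbers and lists then turn Sim, Plus, Sim~ and Tim into
-- the equations j = b, j + a = c, and a list identity giving a·b = c.

mutual
  evalE : (M : Structure) {X : Set} → (X → Carrier M) → Term X → Carrier M
  evalE M ρ (var x) = ρ x
  evalE M ρ (app f ts) = fun M f (evalsE M ρ ts)

  evalsE : (M : Structure) {X : Set} → (X → Carrier M) → ∀ {n} → Vec (Term X) n → Vec (Carrier M) n
  evalsE M ρ [] = []
  evalsE M ρ (t ∷ ts) = evalE M ρ t ∷ evalsE M ρ ts

SatE : (M : Structure) {X : Set} → (X → Carrier M) → Formula X → Set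
SatE M ρ (s ≐ t) = evalE M ρ s ≡ evalE M ρ t
SatE M ρ (rel n i ts) = prd M n i (evalsE M ρ ts)
SatE M ρ ff = ⊥
SatE M ρ (¬' φ) = ¬ SatE M ρ φ
SatE M ρ (φ ∧ χ) = SatE M ρ φ × SatE M ρ χ
SatE M ρ (φ ∨ χ) = SatE M ρ φ ⊎ SatE M ρ χ
SatE M ρ (φ ⇒ χ) = SatE M ρ φ → SatE M ρ χ

mutual
  eval-substT : (M : Structure) {X : Set} (σ : X → Term ⊥) (t : Term X) →
    eval M (substT σ t) ≡ evalE M (eval M ∘ σ) t
  eval-substT M σ (var x) = refl
  eval-substT M σ (app f ts) = cong (fun M f) (evals-substTs M σ ts)

  evals-substTs : (M : Structure) {X : Set} (σ : X → Term ⊥) {n : ℕ} (ts : Vec (Term X) n) →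
    evals M (substTs σ ts) ≡ evalsE M (eval M ∘ σ) ts
  evals-substTs M σ [] = refl
  evals-substTs M σ (t ∷ ts) = cong₂ _∷_ (eval-substT M σ t) (evals-substTs M σ ts)

sat-substF : (M : Structure) {X : Set} (σ : X → Term ⊥) (φ : Formula X) →
  Sat M (substF σ φ) ≡ SatE M (eval M ∘ σ) φ
sat-substF M σ (s ≐ t) = cong₂ _≡_ (eval-substT M σ s) (eval-substT M σ t)
sat-substF M σ (rel n i ts) = cong (prd M n i) (evals-substTs M σ ts)
sat-substF M σ ff = refl
sat-substF M σ (¬' φ) = cong ¬_ (sat-substF M σ φ)
sat-substF M σ (φ ∧ χ) = cong₂ _×_ (sat-substF M σ φ) (sat-substF M σ χ)
sat-substF M σ (φ ∨ χ) = cong₂ _⊎_ (sat-substF M σ φ) (sat-substF M σ χ)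
sat-substF M σ (φ ⇒ χ) = cong₂ (λ A B → A → B) (sat-substF M σ φ) (sat-substF M σ χ)

_⟨_⟩ : Structure → (ℕ → Term ⊥) → Structure
M ⟨ a ⟩ = record { Carrier = Carrier M ; fun = F ; prd = prd M }
  where
  F : (f : Sym) → Vec (Carrier M) (arity f) → Carrier M
  F s0 xs = fun M s0 xs
  F ŝ0 xs = fun M ŝ0 xs
  F s̃0 xs = fun M s̃0 xs
  F sk xs = fun M sk xs
  F s̃k xs = fun M s̃k xs
  F sS xs = fun M sS xs
  F spr xs = fun M spr xs
  F (unk i) xs = eval M (a i)
  F (extra n i) xs = fun M (extra n i) xs

mutual
  eval-substUT : (M : Structure) (a : ℕ → Term ⊥) (t : Term ⊥) →
    eval M (substUT a t) ≡ eval (M ⟨ a ⟩) t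
  eval-substUT M a (var ())
  eval-substUT M a (app (unk i) ts) = refl
  eval-substUT M a (app s0 ts) = cong (fun M s0) (evals-substUTs M a ts)
  eval-substUT M a (app ŝ0 ts) = cong (fun M ŝ0) (evals-substUTs M a ts)
  eval-substUT M a (app s̃0 ts) = cong (fun M s̃0) (evals-substUTs M a ts)
  eval-substUT M a (app sk ts) = cong (fun M sk) (evals-substUTs M a ts)
  eval-substUT M a (app s̃k ts) = cong (fun M s̃k) (evals-substUTs M a ts)
  eval-substUT M a (app sS ts) = cong (fun M sS) (evals-substUTs M a ts)
  eval-substUT M a (app spr ts) = cong (fun M spr) (evals-substUTs M a ts)
  eval-substUT M a (app (extra n i) ts) = cong (fun M (extra n i)) (evals-substUTs M a ts)

  evals-substUTs : (M : Structure) (a : ℕ → Term ⊥) {n : ℕ} (ts : Vec (Term ⊥) n) →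
    evals M (substUTs a ts) ≡ evals (M ⟨ a ⟩) ts
  evals-substUTs M a [] = refl
  evals-substUTs M a (t ∷ ts) = cong₂ _∷_ (eval-substUT M a t) (evals-substUTs M a ts)

sat-substUF : (M : Structure) (a : ℕ → Term ⊥) (θ : Formula ⊥) →
  Sat M (substUF a θ) ≡ Sat (M ⟨ a ⟩) θ
sat-substUF M a (s ≐ t) = cong₂ _≡_ (eval-substUT M a s) (eval-substUT M a t)
sat-substUF M a (rel n i ts) = cong (prd M n i) (evals-substUTs M a ts)
sat-substUF M a ff = refl
sat-substUF M a (¬' φ) = cong ¬_ (sat-substUF M a φ)
sat-substUF M a (φ ∧ χ) = cong₂ _×_ (sat-substUF M a φ) (sat-substUF M a χ)
sat-substUF M a (φ ∨ χ) = cong₂ _⊎_ (sat-substUF M a φ) (sat-substUF M a χ)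
sat-substUF M a (φ ⇒ χ) = cong₂ (λ A B → A → B) (sat-substUF M a φ) (sat-substUF M a χ)

mutual
  eval-expand-noUnk : (M : Structure) (a : ℕ → Term ⊥) (t : Term ⊥) → NoUnk t →
    eval (M ⟨ a ⟩) t ≡ eval M t
  eval-expand-noUnk M a (var ()) _
  eval-expand-noUnk M a (app (unk i) ts) ()
  eval-expand-noUnk M a (app s0 ts) h = cong (fun M s0) (evals-expand-noUnk M a ts h)
  eval-expand-noUnk M a (app ŝ0 ts) h = cong (fun M ŝ0) (evals-expand-noUnk M a ts h)
  eval-expand-noUnk M a (app s̃0 ts) h = cong (fun M s̃0) (evals-expand-noUnk M a ts h)
  eval-expand-noUnk M a (app sk ts) h = cong (fun M sk) (evals-expand-noUnk M a ts h)
  eval-expand-noUnk M a (app s̃k ts) h = cong (fun M s̃k) (evals-expand-noUnk M a ts h)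
  eval-expand-noUnk M a (app sS ts) h = cong (fun M sS) (evals-expand-noUnk M a ts h)
  eval-expand-noUnk M a (app spr ts) h = cong (fun M spr) (evals-expand-noUnk M a ts h)
  eval-expand-noUnk M a (app (extra n i) ts) h = cong (fun M (extra n i)) (evals-expand-noUnk M a ts h)

  evals-expand-noUnk : (M : Structure) (a : ℕ → Term ⊥) {n : ℕ} (ts : Vec (Term ⊥) n) → NoUnks ts →
    evals (M ⟨ a ⟩) ts ≡ evals M ts
  evals-expand-noUnk M a [] _ = refl
  evals-expand-noUnk M a (t ∷ ts) (h , hs) =
    cong₂ _∷_ (eval-expand-noUnk M a t h) (evals-expand-noUnk M a ts hs)

tableEnv : (M : Structure) (a : ℕ → Term ⊥) (u : ℕ → ℕ) → ⊥ ⊎ ℕ → Carrier M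
tableEnv M a u x = eval (M ⟨ a ⟩) (unknownsFor u x)

sat-instance : (M : Structure) (a : ℕ → Term ⊥) (u : ℕ → ℕ) (φ : Formula (⊥ ⊎ ℕ)) →
  Sat M (substUF a (substF (unknownsFor u) φ)) ≡ SatE (M ⟨ a ⟩) (tableEnv M a u) φ
sat-instance M a u φ =
  trans (sat-substUF M a (substF (unknownsFor u) φ)) (sat-substF (M ⟨ a ⟩) (unknownsFor u) φ)

succ : (N : Structure) → Carrier N → Carrier N
succ N x = fun N sS (x ∷ [])

pair : (N : Structure) → Carrier N → Carrier N → Carrier N
pair N x y = fun N spr (x ∷ y ∷ [])

iter : (N : Structure) → ℕ → Carrier N → Carrier N
iter N zero x = x
iter N (suc m) x = succ N (iter N m x)

evalE-S^ : (N : Structure) {X : Set} (ρ : X → Carrier N) (m : ℕ) (t : Term X) →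
  evalE N ρ (P.S^ m t) ≡ iter N m (evalE N ρ t)
evalE-S^ N ρ zero t = refl
evalE-S^ N ρ (suc m) t = cong (succ N) (evalE-S^ N ρ m t)

eval-S^ : (N : Structure) (m : ℕ) (t : Term ⊥) → eval N (P.S^ m t) ≡ iter N m (eval N t)
eval-S^ N zero t = refl
eval-S^ N (suc m) t = cong (succ N) (eval-S^ N m t)

iter-fixed : (N : Structure) {x : Carrier N} → x ≡ succ N x → (m : ℕ) → x ≡ iter N m x
iter-fixed N x-fix zero = refl
iter-fixed N x-fix (suc m) = trans x-fix (cong (succ N) (iter-fixed N x-fix m))

iter-+ : (N : Structure) (a b : ℕ) (x : Carrier N) → iter N a (iter N b x) ≡ iter N (a + b) x
iter-+ N zero b x = refl
iter-+ N (suc a) b x = cong (succ N) (iter-+ N a b x)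

iter-succ : (N : Structure) (n : ℕ) (x : Carrier N) → iter N n (succ N x) ≡ succ N (iter N n x)
iter-succ N zero x = refl
iter-succ N (suc n) x = cong (succ N) (iter-succ N n x)

iter-shift : (N : Structure) (f : ℕ → Carrier N) → (∀ x → succ N (f x) ≡ f (suc x)) →
  ∀ j x → iter N j (f x) ≡ f (j + x)
iter-shift N f step zero x = refl
iter-shift N f step (suc j) x = trans (cong (succ N) (iter-shift N f step j x)) (step (j + x))

noUnk-S^ : (n : ℕ) (t : Term ⊥) → NoUnk t → NoUnk (P.S^ n t)
noUnk-S^ zero t h = h
noUnk-S^ (suc n) t h = noUnk-S^ n t h , tt

tableTerm : Term ⊥ → Term ⊥ → Term ⊥ → List (ℕ × ℕ) → Term ⊥
tableTerm b₁ b₂ κ [] = κ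
tableTerm b₁ b₂ κ ((a , c) ∷ A) = P.pr (P.pr (P.S^ a b₁) (P.S^ c b₂)) (tableTerm b₁ b₂ κ A)

-- Tables as they occur in Tab (plain) and Tab~ (tilde).
plainTable tildeTable : List (ℕ × ℕ) → Term ⊥
plainTable = tableTerm P.𝟘 P.𝟘 P.𝕜
tildeTable = tableTerm P.0̂ P.0̃ P.𝕜̃

noUnk-table : (A : List (ℕ × ℕ)) {b₁ b₂ κ : Term ⊥} →
  NoUnk b₁ → NoUnk b₂ → NoUnk κ → NoUnk (tableTerm b₁ b₂ κ A)
noUnk-table [] h₁ h₂ hκ = hκ
noUnk-table ((a , c) ∷ A) {b₁} {b₂} h₁ h₂ hκ =
  (noUnk-S^ a b₁ h₁ , noUnk-S^ c b₂ h₂ , tt) , noUnk-table A h₁ h₂ hκ , tt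

tableVal : (N : Structure) → Carrier N → Carrier N → Carrier N → List (ℕ × ℕ) → Carrier N
tableVal N x₁ x₂ κ [] = κ
tableVal N x₁ x₂ κ ((a , c) ∷ A) = pair N (pair N (iter N a x₁) (iter N c x₂)) (tableVal N x₁ x₂ κ A)

eval-table : (N : Structure) (b₁ b₂ κ : Term ⊥) (A : List (ℕ × ℕ)) →
  eval N (tableTerm b₁ b₂ κ A) ≡ tableVal N (eval N b₁) (eval N b₂) (eval N κ) A
eval-table N b₁ b₂ κ [] = refl
eval-table N b₁ b₂ κ ((a , c) ∷ A) =
  cong₂ (pair N) (cong₂ (pair N) (eval-S^ N a b₁) (eval-S^ N c b₂)) (eval-table N b₁ b₂ κ A)

tableVal-cong : (N : Structure) {x₁ x₂ κ y₁ y₂ κ′ : Carrier N} →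
  x₁ ≡ y₁ → x₂ ≡ y₂ → κ ≡ κ′ → (A : List (ℕ × ℕ)) → tableVal N x₁ x₂ κ A ≡ tableVal N y₁ y₂ κ′ A
tableVal-cong N refl refl refl A = refl

-- When the bases are fixed by S and κ = pr(pr(x₁, x₂), κ) (the antecedent of
-- Tab and Tab~), every table evaluates to κ.
table-fixed : (N : Structure) {x₁ x₂ κ : Carrier N} → x₁ ≡ succ N x₁ → x₂ ≡ succ N x₂ →
  κ ≡ pair N (pair N x₁ x₂) κ → (A : List (ℕ × ℕ)) → κ ≡ tableVal N x₁ x₂ κ A
table-fixed N fix₁ fix₂ fixκ [] = refl
table-fixed N fix₁ fix₂ fixκ ((a , c) ∷ A) =
  trans fixκ (cong₂ (pair N) (cong₂ (pair N) (iter-fixed N fix₁ a) (iter-fixed N fix₂ c))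
                             (table-fixed N fix₁ fix₂ fixκ A))

mulTable : ℕ → ℕ → List (ℕ × ℕ)
mulTable m zero = []
mulTable m (suc n) = (n , n * m) ∷ mulTable m n

-- Moving the bases of the multiplication table from (z, z) to (S z, S^m z) and
-- its end from κ to pr(pr(z, z), κ) adds the next row (n, n·m) in front:
-- the computation behind Tim.
tableVal-mulTable : (N : Structure) (z κ : Carrier N) (m n : ℕ) →
  tableVal N (succ N z) (iter N m z) (pair N (pair N z z) κ) (mulTable m n)
    ≡ pair N (pair N (iter N n z) (iter N (n * m) z)) (tableVal N z z κ (mulTable m n))
tableVal-mulTable N z κ m zero = refl
tableVal-mulTable N z κ m (suc n) =
  cong₂ (pair N)
    (cong₂ (pair N) (iter-succ N n z)
      (trans (iter-+ N (n * m) m z) (cong (λ k → iter N k z) (+-comm (n * m) m))))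
    (tableVal-mulTable N z κ m n)

tabs-++ : (xs ys : List (⊥ ⊎ ℕ)) → tabs (xs ++ ys) ≡ tabs xs ++ tabs ys
tabs-++ [] ys = refl
tabs-++ (inj₂ w ∷ xs) ys = cong (w ∷_) (tabs-++ xs ys)

tvars-∧ˡ : (φ χ : Formula (⊥ ⊎ ℕ)) {w : ℕ} → w ∈ tvars φ → w ∈ tvars (φ ∧ χ)
tvars-∧ˡ φ χ w∈ = subst (_ ∈_) (sym (tabs-++ (varsF φ) (varsF χ))) (∈-++⁺ˡ w∈)

tvars-∧ʳ : (φ χ : Formula (⊥ ⊎ ℕ)) {w : ℕ} → w ∈ tvars χ → w ∈ tvars (φ ∧ χ)
tvars-∧ʳ φ χ w∈ = subst (_ ∈_) (sym (tabs-++ (varsF φ) (varsF χ))) (∈-++⁺ʳ (tvars φ) w∈)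

numeral : ℕ → Term (⊥ ⊎ ℕ)
numeral m = trD (dnum m)

numerals∧ : ℕ → ℕ → ℕ → Formula (⊥ ⊎ ℕ) → Formula (⊥ ⊎ ℕ)
numerals∧ m n p χ = P.Num (numeral m) ∧ P.Num (numeral n) ∧ P.Num (numeral p) ∧ χ

tvars-numerals∧ : (m n p : ℕ) (χ : Formula (⊥ ⊎ ℕ)) {w : ℕ} →
  w ∈ tvars χ → w ∈ tvars (numerals∧ m n p χ)
tvars-numerals∧ m n p χ w∈ =
  tvars-∧ʳ (P.Num (numeral m)) (P.Num (numeral n) ∧ P.Num (numeral p) ∧ χ)
    (tvars-∧ʳ (P.Num (numeral n)) (P.Num (numeral p) ∧ χ) (tvars-∧ʳ (P.Num (numeral p)) χ w∈))

Realizes : Formula (⊥ ⊎ ℕ) → (ℕ → Term ⊥) → Set₁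
Realizes φ g = (N : Structure) (ρ : ⊥ ⊎ ℕ → Carrier N) →
  (∀ {w} → w ∈ tvars φ → ρ (inj₂ w) ≡ eval N (g w)) → SatE N ρ φ

record Realizable (φ : Formula (⊥ ⊎ ℕ)) : Set₁ where
  field
    witness : ℕ → Term ⊥
    unknownFree : (w : ℕ) → NoUnk (witness w)
    realizes : Realizes φ witness

-- Num(S^k 0) holds everywhere: a fixed point of S is fixed by S^k.
num-numeral : (N : Structure) (ρ : ⊥ ⊎ ℕ → Carrier N) (k : ℕ) → SatE N ρ (P.Num (numeral k))
num-numeral N ρ k 0-fix = trans (iter-fixed N 0-fix k) (sym (evalE-S^ N ρ k P.𝟘))

realize-numerals : (m n p : ℕ) (χ : Formula (⊥ ⊎ ℕ)) (g : ℕ → Term ⊥) →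
  Realizes χ g → Realizes (numerals∧ m n p χ) g
realize-numerals m n p χ g r N ρ agree =
  num-numeral N ρ m , num-numeral N ρ n , num-numeral N ρ p ,
  r N ρ (λ w∈ → agree (tvars-numerals∧ m n p χ w∈))

-- m + n = p is realized by taking S^n(0̃) for the table variable of Add.
realize-add : (m n p w : ℕ) → m + n ≡ p →
  Realizable (numerals∧ m n p (P.Add (numeral m) (numeral n) (numeral p) (tv w)))
realize-add m n p w m+n≡p = record
  { witness = λ _ → P.S^ n P.0̃
  ; unknownFree = λ _ → noUnk-S^ n P.0̃ tt
  ; realizes = realize-numerals m n p (P.Add (numeral m) (numeral n) (numeral p) (tv w)) (λ _ → P.S^ n P.0̃) add
  }
  where
  add : Realizes (P.Add (numeral m) (numeral n) (numeral p) (tv w)) (λ _ → P.S^ n P.0̃)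
  add N ρ agree = num~ , sim , plus
    where
    z c : Carrier N
    z = fun N s0 []
    c = fun N s̃0 []
    w-value : ρ (inj₂ w) ≡ iter N n c
    w-value = trans (agree (here refl)) (eval-S^ N n P.0̃)
    num~ : c ≡ succ N c → c ≡ ρ (inj₂ w)
    num~ c-fix = trans (iter-fixed N c-fix n) (sym w-value)
    sim : z ≡ c → evalE N ρ (numeral n) ≡ ρ (inj₂ w)
    sim z≡c = trans (evalE-S^ N ρ n P.𝟘) (trans (cong (iter N n) z≡c) (sym w-value))
    plus : c ≡ evalE N ρ (numeral m) → evalE N ρ (numeral p) ≡ ρ (inj₂ w)
    plus c≡m = begin
      evalE N ρ (numeral p)             ≡⟨ evalE-S^ N ρ p P.𝟘 ⟩
      iter N p z                        ≡⟨ cong (λ k → iter N k z) (trans (sym m+n≡p) (+-comm m n)) ⟩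
      iter N (n + m) z                  ≡⟨ sym (iter-+ N n m z) ⟩
      iter N n (iter N m z)             ≡⟨ cong (iter N n) (sym (evalE-S^ N ρ m P.𝟘)) ⟩
      iter N n (evalE N ρ (numeral m))  ≡⟨ cong (iter N n) (sym c≡m) ⟩
      iter N n c                        ≡⟨ sym w-value ⟩
      ρ (inj₂ w)                        ∎

choose : {A : Set} {P : ℕ → Set} → Decidable P → (ℕ → A) → (ℕ → A) → ℕ → A
choose P? f g v with P? v
... | yes _ = f v
... | no _ = g v

choose-yes : {A : Set} {P : ℕ → Set} (P? : Decidable P) (f g : ℕ → A) {v : ℕ} →
  P v → choose P? f g v ≡ f v
choose-yes P? f g {v} pv with P? v
... | yes _ = refl
... | no ¬pv = contradiction pv ¬pv

choose-no : {A : Set} {P : ℕ → Set} (P? : Decidable P) (f g : ℕ → A) {v : ℕ} →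
  ¬ P v → choose P? f g v ≡ g v
choose-no P? f g {v} ¬pv with P? v
... | yes pv = contradiction pv ¬pv
... | no _ = refl

choose-preserves : {A : Set} {P : ℕ → Set} (P? : Decidable P) {f g : ℕ → A} (Q : A → Set) →
  (∀ v → Q (f v)) → (∀ v → Q (g v)) → ∀ v → Q (choose P? f g v)
choose-preserves P? Q qf qg v with P? v
... | yes _ = qf v
... | no _ = qg v

-- m · n = p is realized by the multiplication table of m below n, as a plain
-- table for the first table variable and a tilde table for the second.
realize-mul : (m n p w₁ w₂ : ℕ) → w₁ ≢ w₂ → m * n ≡ p →
  Realizable (numerals∧ m n p (P.Mul (numeral m) (numeral n) (numeral p) (tv w₁) (tv w₂)))
realize-mul m n p w₁ w₂ w₁≢w₂ m*n≡p = record
  { witness = tables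
  ; unknownFree = choose-preserves (_≟ w₁) NoUnk (λ _ → noUnk-table A tt tt tt) (λ _ → noUnk-table A tt tt tt)
  ; realizes = realize-numerals m n p (P.Mul (numeral m) (numeral n) (numeral p) (tv w₁) (tv w₂)) tables mul
  }
  where
  A : List (ℕ × ℕ)
  A = mulTable m n
  tables : ℕ → Term ⊥
  tables = choose (_≟ w₁) (λ _ → plainTable A) (λ _ → tildeTable A)
  mul : Realizes (P.Mul (numeral m) (numeral n) (numeral p) (tv w₁) (tv w₂)) tables
  mul N ρ agree = tab , tab~ , sim~ , tim
    where
    z ẑ z̃ k k̃ : Carrier N
    z = fun N s0 []
    ẑ = fun N ŝ0 []
    z̃ = fun N s̃0 []
    k = fun N sk []
    k̃ = fun N s̃k []
    w₁-value : ρ (inj₂ w₁) ≡ tableVal N z z k A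
    w₁-value = trans (agree (here refl))
      (trans (cong (eval N) (choose-yes (_≟ w₁) _ _ refl)) (eval-table N _ _ _ A))
    w₂-value : ρ (inj₂ w₂) ≡ tableVal N ẑ z̃ k̃ A
    w₂-value = trans (agree (there (here refl)))
      (trans (cong (eval N) (choose-no (_≟ w₁) (λ _ → plainTable A) (λ _ → tildeTable A) (w₁≢w₂ ∘ sym)))
             (eval-table N _ _ _ A))
    tab : z ≡ succ N z × k ≡ pair N (pair N z z) k → k ≡ ρ (inj₂ w₁)
    tab (z-fix , k-fix) = trans (table-fixed N z-fix z-fix k-fix A) (sym w₁-value)
    tab~ : ẑ ≡ succ N ẑ × z̃ ≡ succ N z̃ × k̃ ≡ pair N (pair N ẑ z̃) k̃ → k̃ ≡ ρ (inj₂ w₂)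
    tab~ (ẑ-fix , z̃-fix , k̃-fix) = trans (table-fixed N ẑ-fix z̃-fix k̃-fix A) (sym w₂-value)
    sim~ : z ≡ ẑ × z ≡ z̃ × k ≡ k̃ → ρ (inj₂ w₁) ≡ ρ (inj₂ w₂)
    sim~ (z≡ẑ , z≡z̃ , k≡k̃) = trans w₁-value (trans (tableVal-cong N z≡ẑ z≡z̃ k≡k̃ A) (sym w₂-value))
    n·m-value : iter N (n * m) z ≡ evalE N ρ (numeral p)
    n·m-value = trans (cong (λ j → iter N j z) (trans (*-comm n m) m*n≡p)) (sym (evalE-S^ N ρ p P.𝟘))
    tim : ẑ ≡ succ N z × z̃ ≡ evalE N ρ (numeral m) × k̃ ≡ pair N (pair N z z) k →
      ρ (inj₂ w₂) ≡ pair N (pair N (evalE N ρ (numeral n)) (evalE N ρ (numeral p))) (ρ (inj₂ w₁))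
    tim (ẑ≡Sz , z̃≡m , k̃≡zzk) = begin
      ρ (inj₂ w₂)
        ≡⟨ w₂-value ⟩
      tableVal N ẑ z̃ k̃ A
        ≡⟨ tableVal-cong N ẑ≡Sz (trans z̃≡m (evalE-S^ N ρ m P.𝟘)) k̃≡zzk A ⟩
      tableVal N (succ N z) (iter N m z) (pair N (pair N z z) k) A
        ≡⟨ tableVal-mulTable N z k m n ⟩
      pair N (pair N (iter N n z) (iter N (n * m) z)) (tableVal N z z k A)
        ≡⟨ cong₂ (pair N) (cong₂ (pair N) (sym (evalE-S^ N ρ n P.𝟘)) n·m-value) (sym w₁-value) ⟩
      pair N (pair N (evalE N ρ (numeral n)) (evalE N ρ (numeral p))) (ρ (inj₂ w₁))
        ∎

-- Realizers of the two conjuncts combine, their table variables being disjoint.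
realize-∧ : {φ₁ φ₂ : Formula (⊥ ⊎ ℕ)} → Disjoint (tvars φ₁) (tvars φ₂) →
  Realizable φ₁ → Realizable φ₂ → Realizable (φ₁ ∧ φ₂)
realize-∧ {φ₁} {φ₂} disjoint r₁ r₂ = record
  { witness = g
  ; unknownFree = choose-preserves in₁? NoUnk R₁.unknownFree R₂.unknownFree
  ; realizes = λ N ρ agree →
      R₁.realizes N ρ (λ w∈ → trans (agree (tvars-∧ˡ φ₁ φ₂ w∈))
                                  (cong (eval N) (choose-yes in₁? R₁.witness R₂.witness w∈))) ,
      R₂.realizes N ρ (λ w∈ → trans (agree (tvars-∧ʳ φ₁ φ₂ w∈))
                                  (cong (eval N) (choose-no in₁? R₁.witness R₂.witness
                                                             (λ w∈₁ → disjoint (w∈₁ , w∈)))))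
  }
  where
  module R₁ = Realizable r₁
  module R₂ = Realizable r₂
  in₁? : Decidable (_∈ tvars φ₁)
  in₁? = _∈? tvars φ₁
  g : ℕ → Term ⊥
  g = choose in₁? R₁.witness R₂.witness

realize : {ψ : DForm ⊥} {φ : Formula (⊥ ⊎ ℕ)} → Assoc ψ φ → NSat ψ → Realizable φ
realize (assoc+ (dvar ()) _ _ _) _
realize (assoc+ (dnum _) (dvar ()) _ _) _
realize (assoc+ (dnum _) (dnum _) (dvar ()) _) _
realize (assoc+ (dnum m) (dnum n) (dnum p) w) m+n≡p = realize-add m n p w m+n≡p
realize (assoc· (dvar ()) _ _ _ _ _) _
realize (assoc· (dnum _) (dvar ()) _ _ _ _) _
realize (assoc· (dnum _) (dnum _) (dvar ()) _ _ _) _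
realize (assoc· (dnum m) (dnum n) (dnum p) w₁ w₂ w₁≢w₂) m*n≡p =
  realize-mul m n p w₁ w₂ w₁≢w₂ m*n≡p
realize (assoc∧ assoc₁ assoc₂ disjoint) (true₁ , true₂) =
  realize-∧ disjoint (realize assoc₁ true₁) (realize assoc₂ true₂)

InjectiveOn : (ℕ → ℕ) → List ℕ → Set
InjectiveOn u L = ∀ {w w′} → w ∈ L → w′ ∈ L → u w ≡ u w′ → w ≡ w′

-- Values for the unknowns: the unknown i gets g w for some w ∈ L with u w ≡ i
-- (and an arbitrary term without unknowns when there is none).
solution : (u : ℕ → ℕ) (g : ℕ → Term ⊥) (L : List ℕ) → ℕ → Term ⊥
solution u g L i with any? (λ w → u w ≟ i) L
... | yes found = g (Any.lookup found)
... | no _ = P.𝟘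

solution-noUnk : (u : ℕ → ℕ) (g : ℕ → Term ⊥) (L : List ℕ) →
  (∀ w → NoUnk (g w)) → ∀ i → NoUnk (solution u g L i)
solution-noUnk u g L g-noUnk i with any? (λ w → u w ≟ i) L
... | yes found = g-noUnk (Any.lookup found)
... | no _ = tt

solution-correct : (u : ℕ → ℕ) (g : ℕ → Term ⊥) (L : List ℕ) → InjectiveOn u L →
  ∀ {w} → w ∈ L → solution u g L (u w) ≡ g w
solution-correct u g L u-inj {w} w∈ with any? (λ w′ → u w′ ≟ u w) L
... | yes found = cong g (u-inj (∈-lookup (Any.index found)) w∈ (lookup-result found))
... | no none = contradiction (Any.map (λ w≡ → cong u (sym w≡)) w∈) none

-- (⇒) A true ψ makes φ(*̄) solvable: the unknowns take the realizing terms.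
solvable-if-true : {ψ : DForm ⊥} {φ : Formula (⊥ ⊎ ℕ)} → Assoc ψ φ →
  (u : ℕ → ℕ) → InjectiveOn u (tvars φ) → NSat ψ → Solvable (substF (unknownsFor u) φ)
solvable-if-true {φ = φ} assoc u u-inj ψ-true = a , solution-noUnk u witness (tvars φ) unknownFree , valid
  where
  open Realizable (realize assoc ψ-true)
  a : ℕ → Term ⊥
  a = solution u witness (tvars φ)
  valid : Valid (substUF a (substF (unknownsFor u) φ))
  valid M = subst id (sym (sat-instance M a u φ)) (realizes (M ⟨ a ⟩) (tableEnv M a u) agree)
    where
    agree : ∀ {w} → w ∈ tvars φ → eval M (a (u w)) ≡ eval (M ⟨ a ⟩) (witness w)
    agree {w} w∈ = trans (cong (eval M) (solution-correct u witness (tvars φ) u-inj w∈))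
                         (sym (eval-expand-noUnk M a (witness w) (unknownFree w)))

-- Values of the recognizer structures: the shapes of numerals over the first or
-- second base, of table entries, and of tables; anything else is `other`.
data Shape : Set where
  numeral₁ numeral₂ entry table other : Shape

Decoded : (b₁ b₂ κ : Term ⊥) → Shape → Term ⊥ → Set
Decoded b₁ b₂ κ numeral₁ t = ∃[ j ] t ≡ P.S^ j b₁
Decoded b₁ b₂ κ numeral₂ t = ∃[ j ] t ≡ P.S^ j b₂
Decoded b₁ b₂ κ entry t = ∃[ i ] ∃[ j ] t ≡ P.pr (P.S^ i b₁) (P.S^ j b₂)
Decoded b₁ b₂ κ table t = ∃[ A ] t ≡ tableTerm b₁ b₂ κ A
Decoded b₁ b₂ κ other t = ⊤

-- S fixes the numeral shapes (so that the bases are fixed points of S).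
succShape : Shape → Shape
succShape numeral₁ = numeral₁
succShape numeral₂ = numeral₂
succShape _ = other

decode-S : (b₁ b₂ κ : Term ⊥) (x : Shape) (t : Term ⊥) →
  Decoded b₁ b₂ κ x t → Decoded b₁ b₂ κ (succShape x) (P.S t)
decode-S b₁ b₂ κ numeral₁ t (j , refl) = suc j , refl
decode-S b₁ b₂ κ numeral₂ t (j , refl) = suc j , refl
decode-S b₁ b₂ κ entry t _ = tt
decode-S b₁ b₂ κ table t _ = tt
decode-S b₁ b₂ κ other t _ = tt

-- Recognizer of tilde tables: 0̂ and 0̃ are numerals of the first and second
-- kind, 𝕜̃ is a table, and pr forms entries and tables.  The antecedents of
-- Num~ and Tab~ hold in it.
pairTilde : Shape → Shape → Shape
pairTilde numeral₁ numeral₂ = entry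
pairTilde entry table = table
pairTilde _ _ = other

TildeRec : Structure
TildeRec = record { Carrier = Shape ; fun = F ; prd = λ _ _ _ → ⊤ }
  where
  F : (f : Sym) → Vec Shape (arity f) → Shape
  F s0 _ = other
  F ŝ0 _ = numeral₁
  F s̃0 _ = numeral₂
  F sk _ = other
  F s̃k _ = table
  F sS (x ∷ []) = succShape x
  F spr (x ∷ y ∷ []) = pairTilde x y
  F (unk _) _ = other
  F (extra _ _) _ = other

decodePr~ : (x y : Shape) (s t : Term ⊥) → Decoded P.0̂ P.0̃ P.𝕜̃ x s → Decoded P.0̂ P.0̃ P.𝕜̃ y t →
  Decoded P.0̂ P.0̃ P.𝕜̃ (pairTilde x y) (P.pr s t)
decodePr~ numeral₁ numeral₁ s t _ _ = tt
decodePr~ numeral₁ numeral₂ s t (i , refl) (j , refl) = i , j , refl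
decodePr~ numeral₁ entry s t _ _ = tt
decodePr~ numeral₁ table s t _ _ = tt
decodePr~ numeral₁ other s t _ _ = tt
decodePr~ numeral₂ y s t _ _ = tt
decodePr~ entry numeral₁ s t _ _ = tt
decodePr~ entry numeral₂ s t _ _ = tt
decodePr~ entry entry s t _ _ = tt
decodePr~ entry table s t (i , j , refl) (A , refl) = (i , j) ∷ A , refl
decodePr~ entry other s t _ _ = tt
decodePr~ table y s t _ _ = tt
decodePr~ other y s t _ _ = tt

decode~ : (t : Term ⊥) → Decoded P.0̂ P.0̃ P.𝕜̃ (eval TildeRec t) t
decode~ (var ())
decode~ (app s0 []) = tt
decode~ (app ŝ0 []) = 0 , refl
decode~ (app s̃0 []) = 0 , refl
decode~ (app sk []) = tt
decode~ (app s̃k []) = [] , refl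
decode~ (app sS (t ∷ [])) = decode-S P.0̂ P.0̃ P.𝕜̃ (eval TildeRec t) t (decode~ t)
decode~ (app spr (s ∷ t ∷ [])) = decodePr~ (eval TildeRec s) (eval TildeRec t) s t (decode~ s) (decode~ t)
decode~ (app (unk _) _) = tt
decode~ (app (extra _ _) _) = tt

-- Recognizer of plain tables: 𝟘 is the base of both coordinates, 𝕜 a table.
-- The antecedent of Tab holds in it.
pairPlain : Shape → Shape → Shape
pairPlain numeral₁ numeral₁ = entry
pairPlain entry table = table
pairPlain _ _ = other

PlainRec : Structure
PlainRec = record { Carrier = Shape ; fun = F ; prd = λ _ _ _ → ⊤ }
  where
  F : (f : Sym) → Vec Shape (arity f) → Shape
  F s0 _ = numeral₁
  F ŝ0 _ = other
  F s̃0 _ = other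
  F sk _ = table
  F s̃k _ = other
  F sS (x ∷ []) = succShape x
  F spr (x ∷ y ∷ []) = pairPlain x y
  F (unk _) _ = other
  F (extra _ _) _ = other

decodePr : (x y : Shape) (s t : Term ⊥) → Decoded P.𝟘 P.𝟘 P.𝕜 x s → Decoded P.𝟘 P.𝟘 P.𝕜 y t →
  Decoded P.𝟘 P.𝟘 P.𝕜 (pairPlain x y) (P.pr s t)
decodePr numeral₁ numeral₁ s t (i , refl) (j , refl) = i , j , refl
decodePr numeral₁ numeral₂ s t _ _ = tt
decodePr numeral₁ entry s t _ _ = tt
decodePr numeral₁ table s t _ _ = tt
decodePr numeral₁ other s t _ _ = tt
decodePr numeral₂ y s t _ _ = tt
decodePr entry numeral₁ s t _ _ = tt
decodePr entry numeral₂ s t _ _ = tt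
decodePr entry entry s t _ _ = tt
decodePr entry table s t (i , j , refl) (A , refl) = (i , j) ∷ A , refl
decodePr entry other s t _ _ = tt
decodePr table y s t _ _ = tt
decodePr other y s t _ _ = tt

decode : (t : Term ⊥) → Decoded P.𝟘 P.𝟘 P.𝕜 (eval PlainRec t) t
decode (var ())
decode (app s0 []) = 0 , refl
decode (app ŝ0 []) = tt
decode (app s̃0 []) = tt
decode (app sk []) = [] , refl
decode (app s̃k []) = tt
decode (app sS (t ∷ [])) = decode-S P.𝟘 P.𝟘 P.𝕜 (eval PlainRec t) t (decode t)
decode (app spr (s ∷ t ∷ [])) = decodePr (eval PlainRec s) (eval PlainRec t) s t (decode s) (decode t)
decode (app (unk _) _) = tt
decode (app (extra _ _) _) = tt

data Val : Set where
  nat : ℕ → Val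
  ent : ℕ → ℕ → Val
  tbl : List (ℕ × ℕ) → Val
  junk : Val

nat-injective : {x y : ℕ} → nat x ≡ nat y → x ≡ y
nat-injective refl = refl

tbl-injective : {A B : List (ℕ × ℕ)} → tbl A ≡ tbl B → A ≡ B
tbl-injective refl = refl

succVal : Val → Val
succVal (nat x) = nat (suc x)
succVal _ = junk

pairVal : Val → Val → Val
pairVal (nat a) (nat c) = ent a c
pairVal (ent a c) (tbl A) = tbl ((a , c) ∷ A)
pairVal _ _ = junk

-- NT ẑ z̃ K̃: S is the successor and pr builds lists of pairs; 𝟘, 0̂, 0̃ denote
-- 0, ẑ, z̃ and 𝕜, 𝕜̃ the lists [], K̃.
NT : ℕ → ℕ → List (ℕ × ℕ) → Structure
NT ẑ z̃ K̃ = record { Carrier = Val ; fun = F ; prd = λ _ _ _ → ⊤ }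
  where
  F : (f : Sym) → Vec Val (arity f) → Val
  F s0 _ = nat 0
  F ŝ0 _ = nat ẑ
  F s̃0 _ = nat z̃
  F sk _ = tbl []
  F s̃k _ = tbl K̃
  F sS (x ∷ []) = succVal x
  F spr (x ∷ y ∷ []) = pairVal x y
  F (unk _) _ = junk
  F (extra _ _) _ = junk

evalE-numeral-NT : (ẑ z̃ : ℕ) (K̃ : List (ℕ × ℕ)) (a : ℕ → Term ⊥) (ρ : ⊥ ⊎ ℕ → Val) (k : ℕ) →
  evalE (NT ẑ z̃ K̃ ⟨ a ⟩) ρ (numeral k) ≡ nat k
evalE-numeral-NT ẑ z̃ K̃ a ρ k =
  trans (evalE-S^ N ρ k P.𝟘) (trans (iter-shift N nat (λ _ → refl) k 0) (cong nat (+-identityʳ k)))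
  where
  N : Structure
  N = NT ẑ z̃ K̃ ⟨ a ⟩

eval-S^0̃-NT : (ẑ z̃ : ℕ) (K̃ : List (ℕ × ℕ)) (j : ℕ) → eval (NT ẑ z̃ K̃) (P.S^ j P.0̃) ≡ nat (j + z̃)
eval-S^0̃-NT ẑ z̃ K̃ j =
  trans (eval-S^ (NT ẑ z̃ K̃) j P.0̃) (iter-shift (NT ẑ z̃ K̃) nat (λ _ → refl) j z̃)

shift : ℕ → ℕ → List (ℕ × ℕ) → List (ℕ × ℕ)
shift x₁ x₂ [] = []
shift x₁ x₂ ((a , c) ∷ A) = (a + x₁ , c + x₂) ∷ shift x₁ x₂ A

shift-zero : (A : List (ℕ × ℕ)) → shift 0 0 A ++ [] ≡ A
shift-zero [] = refl
shift-zero ((a , c) ∷ A) = cong₂ _∷_ (cong₂ _,_ (+-identityʳ a) (+-identityʳ c)) (shift-zero A)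

tableVal-NT : (ẑ z̃ : ℕ) (K̃ : List (ℕ × ℕ)) (x₁ x₂ : ℕ) (L A : List (ℕ × ℕ)) →
  tableVal (NT ẑ z̃ K̃) (nat x₁) (nat x₂) (tbl L) A ≡ tbl (shift x₁ x₂ A ++ L)
tableVal-NT ẑ z̃ K̃ x₁ x₂ L [] = refl
tableVal-NT ẑ z̃ K̃ x₁ x₂ L ((a , c) ∷ A)
  rewrite iter-shift (NT ẑ z̃ K̃) nat (λ _ → refl) a x₁
        | iter-shift (NT ẑ z̃ K̃) nat (λ _ → refl) c x₂
        | tableVal-NT ẑ z̃ K̃ x₁ x₂ L A = refl

eval-plainTable-NT : (ẑ z̃ : ℕ) (K̃ : List (ℕ × ℕ)) (B : List (ℕ × ℕ)) →
  eval (NT ẑ z̃ K̃) (plainTable B) ≡ tbl B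
eval-plainTable-NT ẑ z̃ K̃ B =
  trans (eval-table (NT ẑ z̃ K̃) _ _ _ B) (trans (tableVal-NT ẑ z̃ K̃ 0 0 [] B) (cong tbl (shift-zero B)))

eval-tildeTable-NT : (ẑ z̃ : ℕ) (K̃ : List (ℕ × ℕ)) (A : List (ℕ × ℕ)) →
  eval (NT ẑ z̃ K̃) (tildeTable A) ≡ tbl (shift ẑ z̃ A ++ K̃)
eval-tildeTable-NT ẑ z̃ K̃ A = trans (eval-table (NT ẑ z̃ K̃) _ _ _ A) (tableVal-NT ẑ z̃ K̃ ẑ z̃ K̃ A)

-- A list A with  shift 1 m A ++ [(0,0)] = (n, p) ∷ A  is the multiplication
-- table of m below n, so p = n·m.
shifted-table-product : (m : ℕ) (A : List (ℕ × ℕ)) (n p : ℕ) →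
  shift 1 m A ++ (0 , 0) ∷ [] ≡ (n , p) ∷ A → p ≡ n * m
shifted-table-product m [] n p refl = refl
shifted-table-product m ((a , c) ∷ A) n p e = begin
  p              ≡⟨ sym (,-injectiveʳ head) ⟩
  c + m          ≡⟨ cong (_+ m) (shifted-table-product m A a c tail) ⟩
  a * m + m      ≡⟨ +-comm (a * m) m ⟩
  suc a * m      ≡⟨ cong (_* m) (+-comm 1 a) ⟩
  (a + 1) * m    ≡⟨ cong (_* m) (,-injectiveˡ head) ⟩
  n * m          ∎
  where
  head : (a + 1 , c + m) ≡ (n , p)
  head = proj₁ (∷-injective e)
  tail : shift 1 m A ++ (0 , 0) ∷ [] ≡ (a , c) ∷ A
  tail = proj₂ (∷-injective e)

record HoldsEverywhere (a : ℕ → Term ⊥) (u : ℕ → ℕ) (φ : Formula (⊥ ⊎ ℕ)) : Set₁ where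
  constructor everywhere
  field holdsIn : (M : Structure) → SatE (M ⟨ a ⟩) (tableEnv M a u) φ
open HoldsEverywhere

drop-numerals : {a : ℕ → Term ⊥} {u : ℕ → ℕ} (m n p : ℕ) (χ : Formula (⊥ ⊎ ℕ)) →
  HoldsEverywhere a u (numerals∧ m n p χ) → HoldsEverywhere a u χ
drop-numerals m n p χ holds = everywhere λ M → proj₂ (proj₂ (proj₂ (holdsIn holds M)))

-- Num~ in TildeRec: the value of the table variable of Add is a numeral S^j(0̃).
add-shape : {a : ℕ → Term ⊥} {u : ℕ → ℕ} {x y z : Term (⊥ ⊎ ℕ)} {w : ℕ} →
  HoldsEverywhere a u (P.Add x y z (tv w)) → ∃[ j ] a (u w) ≡ P.S^ j P.0̃
add-shape {a} {u} {w = w} holds =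
  subst (λ s → Decoded P.0̂ P.0̃ P.𝕜̃ s (a (u w)))
        (sym (proj₁ (holdsIn holds TildeRec) refl)) (decode~ (a (u w)))

-- Sim and Plus in NT: the numeral S^j(0̃) witnesses n = j and j + m = p.
add-law : {a : ℕ → Term ⊥} {u : ℕ → ℕ} (m n p w j : ℕ) →
  HoldsEverywhere a u (P.Add (numeral m) (numeral n) (numeral p) (tv w)) →
  a (u w) ≡ P.S^ j P.0̃ → m + n ≡ p
add-law {a} {u} m n p w j holds w≡S^j0̃ = begin
  m + n  ≡⟨ cong (m +_) n≡j ⟩
  m + j  ≡⟨ +-comm m j ⟩
  j + m  ≡⟨ sym p≡j+m ⟩
  p      ∎
  where
  w-value : ∀ ẑ z̃ K̃ → eval (NT ẑ z̃ K̃) (a (u w)) ≡ nat (j + z̃)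
  w-value ẑ z̃ K̃ = trans (cong (eval (NT ẑ z̃ K̃)) w≡S^j0̃) (eval-S^0̃-NT ẑ z̃ K̃ j)
  -- Sim in NT 0 0 [], where 𝟘 = 0̃.
  sim : nat n ≡ nat (j + 0)
  sim = trans (sym (evalE-numeral-NT 0 0 [] a _ n))
              (trans (proj₁ (proj₂ (holdsIn holds (NT 0 0 []))) refl) (w-value 0 0 []))
  -- Plus in NT 0 m [], where 0̃ = S^m(𝟘).
  plus : nat p ≡ nat (j + m)
  plus = trans (sym (evalE-numeral-NT 0 m [] a _ p))
               (trans (proj₂ (proj₂ (holdsIn holds (NT 0 m []))) (sym (evalE-numeral-NT 0 m [] a _ m)))
                      (w-value 0 m []))
  n≡j : n ≡ j
  n≡j = trans (nat-injective sim) (+-identityʳ j)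
  p≡j+m : p ≡ j + m
  p≡j+m = nat-injective plus

-- Tab in PlainRec and Tab~ in TildeRec: the values of the table variables of Mul
-- are a plain and a tilde table.
mul-shapes : {a : ℕ → Term ⊥} {u : ℕ → ℕ} {x y z : Term (⊥ ⊎ ℕ)} {w₁ w₂ : ℕ} →
  HoldsEverywhere a u (P.Mul x y z (tv w₁) (tv w₂)) →
  (∃[ B ] a (u w₁) ≡ plainTable B) × (∃[ A ] a (u w₂) ≡ tildeTable A)
mul-shapes {a} {u} {w₁ = w₁} {w₂} holds =
    subst (λ s → Decoded P.𝟘 P.𝟘 P.𝕜 s (a (u w₁)))
          (sym (proj₁ (holdsIn holds PlainRec) (refl , refl))) (decode (a (u w₁)))
  , subst (λ s → Decoded P.0̂ P.0̃ P.𝕜̃ s (a (u w₂)))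
          (sym (proj₁ (proj₂ (holdsIn holds TildeRec)) (refl , refl , refl))) (decode~ (a (u w₂)))

-- Sim~ in NT 0 0 [] identifies the two tables; Tim in NT 1 m [(0,0)] then says
-- that shifting the table by (1, m) and appending (0,0) prepends (n, p).
mul-law : {a : ℕ → Term ⊥} {u : ℕ → ℕ} (m n p w₁ w₂ : ℕ) (A B : List (ℕ × ℕ)) →
  HoldsEverywhere a u (P.Mul (numeral m) (numeral n) (numeral p) (tv w₁) (tv w₂)) →
  a (u w₁) ≡ plainTable B → a (u w₂) ≡ tildeTable A → m * n ≡ p
mul-law {a} {u} m n p w₁ w₂ A B holds w₁≡B w₂≡A =
  trans (*-comm m n) (sym (shifted-table-product m A n p table-equation))
  where
  w₁-value : ∀ ẑ z̃ K̃ → eval (NT ẑ z̃ K̃) (a (u w₁)) ≡ tbl B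
  w₁-value ẑ z̃ K̃ = trans (cong (eval (NT ẑ z̃ K̃)) w₁≡B) (eval-plainTable-NT ẑ z̃ K̃ B)
  w₂-value : ∀ ẑ z̃ K̃ → eval (NT ẑ z̃ K̃) (a (u w₂)) ≡ tbl (shift ẑ z̃ A ++ K̃)
  w₂-value ẑ z̃ K̃ = trans (cong (eval (NT ẑ z̃ K̃)) w₂≡A) (eval-tildeTable-NT ẑ z̃ K̃ A)
  B≡A : B ≡ A
  B≡A = tbl-injective (begin
    tbl B
      ≡⟨ sym (w₁-value 0 0 []) ⟩
    eval (NT 0 0 []) (a (u w₁))
      ≡⟨ proj₁ (proj₂ (proj₂ (holdsIn holds (NT 0 0 [])))) (refl , refl , refl) ⟩
    eval (NT 0 0 []) (a (u w₂))
      ≡⟨ w₂-value 0 0 [] ⟩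
    tbl (shift 0 0 A ++ [])
      ≡⟨ cong tbl (shift-zero A) ⟩
    tbl A
      ∎)
  tim : tbl (shift 1 m A ++ (0 , 0) ∷ []) ≡ tbl ((n , p) ∷ B)
  tim = begin
    tbl (shift 1 m A ++ (0 , 0) ∷ [])
      ≡⟨ sym (w₂-value 1 m _) ⟩
    eval D (a (u w₂))
      ≡⟨ proj₂ (proj₂ (proj₂ (holdsIn holds D))) (refl , sym (evalE-numeral-NT 1 m _ a _ m) , refl) ⟩
    pairVal (pairVal (evalE (D ⟨ a ⟩) ρ (numeral n)) (evalE (D ⟨ a ⟩) ρ (numeral p))) (eval D (a (u w₁)))
      ≡⟨ cong₂ pairVal (cong₂ pairVal (evalE-numeral-NT 1 m _ a ρ n) (evalE-numeral-NT 1 m _ a ρ p))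
                       (w₁-value 1 m _) ⟩
    tbl ((n , p) ∷ B)
      ∎
    where
    D : Structure
    D = NT 1 m ((0 , 0) ∷ [])
    ρ : ⊥ ⊎ ℕ → Val
    ρ = tableEnv D a u
  table-equation : shift 1 m A ++ (0 , 0) ∷ [] ≡ (n , p) ∷ A
  table-equation = trans (tbl-injective tim) (cong ((n , p) ∷_) B≡A)

true-if-holds : {ψ : DForm ⊥} {φ : Formula (⊥ ⊎ ℕ)} {a : ℕ → Term ⊥} {u : ℕ → ℕ} →
  Assoc ψ φ → HoldsEverywhere a u φ → NSat ψ
true-if-holds (assoc+ (dvar ()) _ _ _) _
true-if-holds (assoc+ (dnum _) (dvar ()) _ _) _
true-if-holds (assoc+ (dnum _) (dnum _) (dvar ()) _) _
true-if-holds (assoc+ (dnum m) (dnum n) (dnum p) w) holds =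
  let add = drop-numerals m n p (P.Add (numeral m) (numeral n) (numeral p) (tv w)) holds
      (j , w≡S^j0̃) = add-shape add
  in add-law m n p w j add w≡S^j0̃
true-if-holds (assoc· (dvar ()) _ _ _ _ _) _
true-if-holds (assoc· (dnum _) (dvar ()) _ _ _ _) _
true-if-holds (assoc· (dnum _) (dnum _) (dvar ()) _ _ _) _
true-if-holds (assoc· (dnum m) (dnum n) (dnum p) w₁ w₂ _) holds =
  let mul = drop-numerals m n p (P.Mul (numeral m) (numeral n) (numeral p) (tv w₁) (tv w₂)) holds
      ((B , w₁≡B) , (A , w₂≡A)) = mul-shapes mul
  in mul-law m n p w₁ w₂ A B mul w₁≡B w₂≡A
true-if-holds (assoc∧ assoc₁ assoc₂ _) holds =
  true-if-holds assoc₁ (everywhere (proj₁ ∘ holdsIn holds)) ,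
  true-if-holds assoc₂ (everywhere (proj₂ ∘ holdsIn holds))

lemma4p5 : (ψ : DForm ⊥) (φ : Formula (⊥ ⊎ ℕ)) → Assoc ψ φ →
    (u : ℕ → ℕ) →
    (∀ {w w′} → w ∈ tvars φ → w′ ∈ tvars φ → u w ≡ u w′ → w ≡ w′) →
    (NSat ψ ⇔ Solvable (substF (unknownsFor u) φ))
lemma4p5 ψ φ assoc u u-inj = mk⇔ (solvable-if-true assoc u u-inj) true-if-solvable
  where
  true-if-solvable : Solvable (substF (unknownsFor u) φ) → NSat ψ
  true-if-solvable (a , _ , valid) =
    true-if-holds assoc (everywhere λ M → subst id (sat-instance M a u φ) (valid M))
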